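{- Let $m>1$ be an integer. Index the fractions of $\mathcal{F}(\mathbb{B}(2m),m)$ in ascending order starting from $0$ (so $\frac01$ has index $0$), and let $t^1_3,t^1_2,t^2_3,t^1_1$ be the indices of $\frac13,\frac12,\frac23,\frac11$ respectively. Then $t^1_2=2t^1_3$, $t^2_3=3t^1_3$ and $t^1_1=4t^1_3$. In particular $|\mathcal{F}(\mathbb{B}(2m),m)|-1$ is divisible by $4$.
   Context: For a positive integer $n$, $\mathcal{F}_n$ is the Farey sequence of order $n$: the ascending sequence of irreducible fractions $\frac hk$ with integers $0\le h\le k\le n$, $k\ge1$. For a positive integer $m$, $\mathcal{F}(\mathbb{B}(2m),m)$ is the ascending sequence $\left(\frac{h}{k}\in\mathcal{F}_{2m}:\ h\le m,\ k-h\le m\right)$. -}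

module Defs where

open import Data.Nat using (ℕ; suc; _+_; _*_; _∸_; _≤?_; _<?_)
open import Data.Nat.GCD using (gcd)
open import Data.Nat.Properties using (_≟_)
open import Data.Product using (_×_; _,_; proj₁; proj₂)
open import Data.List using (List; map; concatMap; upTo; filter; length)
open import Relation.Nullary.Decidable using (_×-dec_)
open import Relation.Binary.PropositionalEquality using (_≡_)

-- A fraction h/k is represented by the pair (h , k).

pairsUpTo : ℕ → List (ℕ × ℕ)
pairsUpTo n = concatMap (λ k → map (λ h → (h , k)) (upTo (suc k))) (map suc (upTo n))

inFB : ℕ → ℕ × ℕ → Set
inFB m (h , k) = (gcd h k ≡ 1) × ((h Data.Nat.≤ m) × ((k ∸ h) Data.Nat.≤ m))

inFB? : (m : ℕ) → (p : ℕ × ℕ) → Relation.Nullary.Decidable.Dec (inFB m p)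
inFB? m (h , k) = (gcd h k ≟ 1) ×-dec ((h ≤? m) ×-dec ((k ∸ h) ≤? m))

FB : ℕ → List (ℕ × ℕ)
FB m = filter (inFB? m) (pairsUpTo (2 * m))

-- Index (starting from 0) of the fraction a/b in the ascending sequence
-- F(B(2m), m): the number of its elements strictly smaller than a/b.
-- h/k < a/b  iff  h * b < a * k  (k, b > 0).
index : ℕ → ℕ → ℕ → ℕ
index m a b = length (filter (λ p → (proj₁ p * b) <? (a * proj₂ p)) (FB m))

-- Write the fractions of F(B(2m),m) as h/(h+j) with h, j ≤ m coprime. The index of a/b counts the
-- coprime pairs of the square [0,m]² on one side of a line through the origin: h/(h+j) lies below
-- 1/3, 1/2, 2/3, 1 iff 2h < j, h < j, h < 2j, 0 < j. The transposition (h , j) ↦ (j , h) exchanges the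
-- two sides of h = j and swaps h > 2j with 2h < j, while (h , j) ↦ (j - h , j) maps the pairs with
-- h < j < 2h onto those with 0 < h and 2h < j. Each of the lines j = 0, h = j, h = 2j, 2h = j, h = 0
-- carries exactly one coprime pair, so with N coprime pairs in all
--   N = t₁ + 1 = 2 t_{1/2} + 1 = t_{2/3} + t_{1/3} + 1   and   t_{1/2} = t_{1/3} + (t_{1/3} - 1) + 1,
-- which gives the ratios 1 : 2 : 3 : 4, and |F(B(2m),m)| - 1 = N - 1 = t₁.

module Submission where

open import Algebra.Properties.CommutativeSemigroup using (interchange)
open import Data.Bool.Base using (true; false; if_then_else_)
open import Data.List.Base using (List; []; _∷_; _++_; map; filter; concatMap; upTo; applyUpTo; length)
open import Data.List.Properties using (map-∘; map-++; map-applyUpTo)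
open import Data.Nat.Base using (ℕ; zero; suc; _+_; _*_; _∸_; _≤_; _<_; z≤n; s≤s; z<s; s<s)
open import Data.Nat.Coprimality using (Coprime; coprime?; coprime⇒gcd≡1; gcd≡1⇒coprime; 1-coprimeTo; 0-coprimeTo-m⇒m≡1)
import Data.Nat.Coprimality as Coprime
open import Data.Nat.Divisibility using (_∣_; ∣-refl; ∣m∣n⇒∣m+n; ∣m+n∣m⇒∣n; m∣m*n)
open import Data.Nat.ListAction using (sum)
open import Data.Nat.ListAction.Properties using (sum-++)
open import Data.Nat.Properties
open import Data.Nat.Tactic.RingSolver using (solve-∀)
open import Data.Product.Base using (_×_; _,_; proj₁; proj₂; map₁)
open import Data.Product.Function.NonDependent.Propositional using (_×-⇔_)
open import Function.Base using (_∘_; id)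
open import Function.Bundles using (_⇔_; mk⇔; Equivalence)
open import Relation.Binary.Definitions using (Decidable; tri<; tri≈; tri>)
open import Relation.Nullary.Decidable using (Dec; does; yes; no; _×-dec_; does-⇔; dec-true; dec-false)
open import Relation.Nullary.Negation using (¬_)
import Relation.Unary as U
open import Relation.Binary.PropositionalEquality using (_≡_; refl; sym; trans; cong; cong₂; subst; module ≡-Reasoning)

open import Defs

private variable
  A B : Set
  P Q : ℕ → ℕ → Set

𝟙 : Dec A → ℕ
𝟙 a? = if does a? then 1 else 0

𝟙-cong : (a? : Dec A) (b? : Dec B) → A ⇔ B → 𝟙 a? ≡ 𝟙 b?
𝟙-cong a? b? A⇔B = cong (λ b → if b then 1 else 0) (does-⇔ A⇔B a? b?)

𝟙-no : (a? : Dec A) → ¬ A → 𝟙 a? ≡ 0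
𝟙-no a? ¬a rewrite dec-false a? ¬a = refl

𝟙-trichotomy : (a? : Dec A) (x y : ℕ) →
  𝟙 a? ≡ 𝟙 (a? ×-dec x <? y) + 𝟙 (a? ×-dec y <? x) + 𝟙 (a? ×-dec x ≟ y)
𝟙-trichotomy (no _)  x y = refl
𝟙-trichotomy (yes _) x y with <-cmp x y
... | tri< x<y x≢y y≮x rewrite dec-true (x <? y) x<y | dec-false (y <? x) y≮x | dec-false (x ≟ y) x≢y = refl
... | tri≈ x≮y x≡y y≮x rewrite dec-false (x <? y) x≮y | dec-false (y <? x) y≮x | dec-true (x ≟ y) x≡y = refl
... | tri> x≮y x≢y y<x rewrite dec-false (x <? y) x≮y | dec-true (y <? x) y<x | dec-false (x ≟ y) x≢y = refl

∑< : ℕ → (ℕ → ℕ) → ℕ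
∑< zero    f = 0
∑< (suc n) f = f 0 + ∑< n (f ∘ suc)

syntax ∑< n (λ i → e) = ∑[ i < n ] e

∑-cong : ∀ n {f g : ℕ → ℕ} → (∀ i → i < n → f i ≡ g i) → ∑< n f ≡ ∑< n g
∑-cong zero    f≗g = refl
∑-cong (suc n) f≗g = cong₂ _+_ (f≗g 0 (s≤s z≤n)) (∑-cong n (λ i i<n → f≗g (suc i) (s≤s i<n)))

∑-zero : ∀ n {f : ℕ → ℕ} → (∀ i → i < n → f i ≡ 0) → ∑< n f ≡ 0
∑-zero zero    f≗0 = refl
∑-zero (suc n) f≗0 = cong₂ _+_ (f≗0 0 (s≤s z≤n)) (∑-zero n (λ i i<n → f≗0 (suc i) (s≤s i<n)))

∑-distrib-+ : ∀ n (f g : ℕ → ℕ) → ∑[ i < n ] (f i + g i) ≡ ∑< n f + ∑< n g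
∑-distrib-+ zero    f g = refl
∑-distrib-+ (suc n) f g =
  trans (cong ((f 0 + g 0) +_) (∑-distrib-+ n (f ∘ suc) (g ∘ suc))) (interchange +-commutativeSemigroup (f 0) (g 0) _ _)

∑-comm : ∀ m n (f : ℕ → ℕ → ℕ) → ∑[ i < m ] ∑[ j < n ] f i j ≡ ∑[ j < n ] ∑[ i < m ] f i j
∑-comm zero    n f = sym (∑-zero n (λ _ _ → refl))
∑-comm (suc m) n f = begin
  ∑< n (f 0) + ∑[ i < m ] ∑[ j < n ] f (suc i) j ≡⟨ cong (∑< n (f 0) +_) (∑-comm m n (f ∘ suc)) ⟩
  ∑< n (f 0) + ∑[ j < n ] ∑[ i < m ] f (suc i) j ≡⟨ sym (∑-distrib-+ n (f 0) (λ j → ∑[ i < m ] f (suc i) j)) ⟩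
  ∑[ j < n ] ∑[ i < suc m ] f i j ∎
  where open ≡-Reasoning

∑-last : ∀ n f → ∑< (suc n) f ≡ ∑< n f + f n
∑-last zero    f = +-comm (f 0) 0
∑-last (suc n) f = trans (cong (f 0 +_) (∑-last n (f ∘ suc))) (sym (+-assoc (f 0) _ _))

∑-reverse : ∀ n f → ∑< (suc n) f ≡ ∑[ i < suc n ] f (n ∸ i)
∑-reverse zero    f = refl
∑-reverse (suc n) f = begin
  ∑< (suc (suc n)) f                           ≡⟨ ∑-last (suc n) f ⟩
  ∑< (suc n) f + f (suc n)                      ≡⟨ cong (_+ f (suc n)) (∑-reverse n f) ⟩
  ∑[ i < suc n ] f (n ∸ i) + f (suc n)          ≡⟨ +-comm _ (f (suc n)) ⟩
  ∑[ i < suc (suc n) ] f (suc n ∸ i) ∎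
  where open ≡-Reasoning

∑-truncate : ∀ n k f → n ≤ k → (∀ i → n ≤ i → f i ≡ 0) → ∑< k f ≡ ∑< n f
∑-truncate zero    k       f _         f≗0 = ∑-zero k (λ i _ → f≗0 i z≤n)
∑-truncate (suc n) (suc k) f (s≤s n≤k) f≗0 =
  cong (f 0 +_) (∑-truncate n k (f ∘ suc) n≤k (λ i n≤i → f≗0 (suc i) (s≤s n≤i)))

∑-triangle : ∀ N (g : ℕ → ℕ → ℕ) → ∑[ k < N ] ∑[ h < suc k ] g h k ≡ ∑[ h < N ] ∑[ j < N ∸ h ] g h (h + j)
∑-triangle zero    g = refl
∑-triangle (suc N) g = begin
  ∑[ k < suc N ] ∑[ h < suc k ] g h k
    ≡⟨ ∑-last N (λ k → ∑[ h < suc k ] g h k) ⟩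
  ∑[ k < N ] ∑[ h < suc k ] g h k + ∑[ h < suc N ] g h N
    ≡⟨ cong (_+ ∑[ h < suc N ] g h N) (∑-triangle N g) ⟩
  ∑[ h < N ] ∑[ j < N ∸ h ] g h (h + j) + ∑[ h < suc N ] g h N
    ≡⟨ cong (_+ ∑[ h < suc N ] g h N) (∑-truncate N (suc N) (λ h → ∑[ j < N ∸ h ] g h (h + j)) (n≤1+n N) empty-row) ⟨
  ∑[ h < suc N ] ∑[ j < N ∸ h ] g h (h + j) + ∑[ h < suc N ] g h N
    ≡⟨ sym (∑-distrib-+ (suc N) (λ h → ∑[ j < N ∸ h ] g h (h + j)) (λ h → g h N)) ⟩
  ∑[ h < suc N ] (∑[ j < N ∸ h ] g h (h + j) + g h N)
    ≡⟨ ∑-cong (suc N) (λ h h<1+N → row h (≤-pred h<1+N)) ⟩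
  ∑[ h < suc N ] ∑[ j < suc N ∸ h ] g h (h + j) ∎
  where
  open ≡-Reasoning
  empty-row : ∀ h → N ≤ h → ∑[ j < N ∸ h ] g h (h + j) ≡ 0
  empty-row h N≤h = cong (λ n → ∑[ j < n ] g h (h + j)) (m≤n⇒m∸n≡0 N≤h)
  row : ∀ h → h ≤ N → ∑[ j < N ∸ h ] g h (h + j) + g h N ≡ ∑[ j < suc N ∸ h ] g h (h + j)
  row h h≤N = begin
    ∑[ j < N ∸ h ] g h (h + j) + g h N             ≡⟨ cong (λ k → ∑[ j < N ∸ h ] g h (h + j) + g h k) (sym (m+[n∸m]≡n h≤N)) ⟩
    ∑[ j < N ∸ h ] g h (h + j) + g h (h + (N ∸ h)) ≡⟨ sym (∑-last (N ∸ h) (λ j → g h (h + j))) ⟩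
    ∑[ j < suc (N ∸ h) ] g h (h + j)               ≡⟨ cong (λ n → ∑[ j < n ] g h (h + j)) (sym (+-∸-assoc 1 h≤N)) ⟩
    ∑[ j < suc N ∸ h ] g h (h + j)                 ∎

∑-𝟙-≡ : ∀ n a → a < n → ∑[ i < n ] 𝟙 (i ≟ a) ≡ 1
∑-𝟙-≡ (suc n) zero    _         = cong suc (∑-zero n (λ _ _ → refl))
∑-𝟙-≡ (suc n) (suc a) (s≤s a<n) =
  trans (∑-cong n (λ i _ → 𝟙-cong (suc i ≟ suc a) (i ≟ a) (mk⇔ suc-injective (cong suc)))) (∑-𝟙-≡ n a a<n)

∑²-distrib-+ : ∀ M (f g : ℕ → ℕ → ℕ) →
  ∑[ h < M ] ∑[ j < M ] (f h j + g h j) ≡ ∑[ h < M ] ∑[ j < M ] f h j + ∑[ h < M ] ∑[ j < M ] g h j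
∑²-distrib-+ M f g = trans (∑-cong M (λ h _ → ∑-distrib-+ M (f h) (g h))) (∑-distrib-+ M _ _)

count : ℕ → {P : ℕ → ℕ → Set} → Decidable P → ℕ
count M P? = ∑[ h < M ] ∑[ j < M ] 𝟙 (P? h j)

count-cong : ∀ M (P? : Decidable P) (Q? : Decidable Q) →
  (∀ h j → h < M → j < M → P h j ⇔ Q h j) → count M P? ≡ count M Q?
count-cong M P? Q? P⇔Q =
  ∑-cong M (λ h h<M → ∑-cong M (λ j j<M → 𝟙-cong (P? h j) (Q? h j) (P⇔Q h j h<M j<M)))

count-transpose : ∀ M (P? : Decidable P) (Q? : Decidable Q) →
  (∀ h j → P h j ⇔ Q j h) → count M P? ≡ count M Q?
count-transpose M P? Q? P⇔Qᵀ =
  trans (∑-comm M M _) (∑-cong M (λ j _ → ∑-cong M (λ h _ → 𝟙-cong (P? h j) (Q? j h) (P⇔Qᵀ h j))))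

count-∅ : ∀ M (P? : Decidable P) → (∀ h j → ¬ P h j) → count M P? ≡ 0
count-∅ M P? ¬P = ∑-zero M (λ h _ → ∑-zero M (λ j _ → 𝟙-no (P? h j) (¬P h j)))

count-point : ∀ M {a b} (P? : Decidable P) → a < M → b < M →
  (∀ h j → P h j ⇔ (h ≡ a × j ≡ b)) → count M P? ≡ 1
count-point M {a} {b} P? a<M b<M P⇔≡ = begin
  count M P?                                  ≡⟨ count-cong M P? (λ h j → h ≟ a ×-dec j ≟ b) (λ h j _ _ → P⇔≡ h j) ⟩
  ∑[ h < M ] ∑[ j < M ] 𝟙 (h ≟ a ×-dec j ≟ b) ≡⟨ ∑-cong M (λ h _ → row (h ≟ a)) ⟩
  ∑[ h < M ] 𝟙 (h ≟ a)                        ≡⟨ ∑-𝟙-≡ M a a<M ⟩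
  1                                           ∎
  where
  open ≡-Reasoning
  row : {A : Set} (a? : Dec A) → ∑[ j < M ] 𝟙 (a? ×-dec j ≟ b) ≡ 𝟙 a?
  row (yes _) = ∑-𝟙-≡ M b b<M
  row (no  _) = ∑-zero M (λ _ _ → refl)

count-trichotomy : ∀ M (P? : Decidable P) (f g : ℕ → ℕ → ℕ) →
  count M P? ≡ count M (λ h j → P? h j ×-dec f h j <? g h j)
             + count M (λ h j → P? h j ×-dec g h j <? f h j)
             + count M (λ h j → P? h j ×-dec f h j ≟ g h j)
count-trichotomy M P? f g = trans
  (∑-cong M (λ h _ → ∑-cong M (λ j _ → 𝟙-trichotomy (P? h j) (f h j) (g h j))))
  (trans (∑²-distrib-+ M (λ h j → lt h j + gt h j) eq) (cong (_+ ∑[ h < M ] ∑[ j < M ] eq h j) (∑²-distrib-+ M lt gt)))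
  where
  lt gt eq : ℕ → ℕ → ℕ
  lt h j = 𝟙 (P? h j ×-dec f h j <? g h j)
  gt h j = 𝟙 (P? h j ×-dec g h j <? f h j)
  eq h j = 𝟙 (P? h j ×-dec f h j ≟ g h j)

count-reflect : ∀ M (P? : Decidable P) (Q? : Decidable Q) →
  (∀ h j → P h j → h ≤ j) → (∀ h j → Q h j → h ≤ j) →
  (∀ h e → P e (h + e) ⇔ Q h (h + e)) → count M P? ≡ count M Q?
count-reflect {P} {Q} M P? Q? P⇒≤ Q⇒≤ P⇔Q = begin
  count M P?                        ≡⟨ ∑-comm M M _ ⟩
  ∑[ j < M ] ∑[ h < M ] 𝟙 (P? h j)  ≡⟨ ∑-cong M column ⟩
  ∑[ j < M ] ∑[ h < M ] 𝟙 (Q? h j)  ≡⟨ ∑-comm M M _ ⟨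
  count M Q?                        ∎
  where
  open ≡-Reasoning
  column : ∀ j → j < M → ∑[ h < M ] 𝟙 (P? h j) ≡ ∑[ h < M ] 𝟙 (Q? h j)
  column j j<M = begin
    ∑[ h < M ] 𝟙 (P? h j)            ≡⟨ up-to-diagonal P? P⇒≤ ⟩
    ∑[ h < suc j ] 𝟙 (P? h j)        ≡⟨ ∑-reverse j (λ h → 𝟙 (P? h j)) ⟩
    ∑[ h < suc j ] 𝟙 (P? (j ∸ h) j)  ≡⟨ ∑-cong (suc j) (λ h h<1+j → 𝟙-cong (P? (j ∸ h) j) (Q? h j) (reflected (≤-pred h<1+j))) ⟩
    ∑[ h < suc j ] 𝟙 (Q? h j)        ≡⟨ up-to-diagonal Q? Q⇒≤ ⟨
    ∑[ h < M ] 𝟙 (Q? h j)            ∎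
    where
    up-to-diagonal : {R : ℕ → ℕ → Set} (R? : Decidable R) → (∀ h j → R h j → h ≤ j) →
      ∑[ h < M ] 𝟙 (R? h j) ≡ ∑[ h < suc j ] 𝟙 (R? h j)
    up-to-diagonal R? R⇒≤ =
      ∑-truncate (suc j) M (λ h → 𝟙 (R? h j)) j<M (λ h j<h → 𝟙-no (R? h j) (<⇒≱ j<h ∘ R⇒≤ h j))
    reflected : ∀ {h} → h ≤ j → P (j ∸ h) j ⇔ Q h j
    reflected {h} h≤j = subst (λ k → P (j ∸ h) k ⇔ Q h k) (m+[n∸m]≡n h≤j) (P⇔Q h (j ∸ h))

length-filter : {P : A → Set} (P? : U.Decidable P) (xs : List A) → length (filter P? xs) ≡ sum (map (𝟙 ∘ P?) xs)
length-filter P? []       = refl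
length-filter P? (x ∷ xs) with does (P? x)
... | true  = cong suc (length-filter P? xs)
... | false = length-filter P? xs

filter-filter : {P Q : A → Set} (P? : U.Decidable P) (Q? : U.Decidable Q) (xs : List A) →
  filter Q? (filter P? xs) ≡ filter (λ x → P? x ×-dec Q? x) xs
filter-filter P? Q? []       = refl
filter-filter P? Q? (x ∷ xs) with does (P? x)
... | false = filter-filter P? Q? xs
... | true with does (Q? x)
...   | true  = cong (x ∷_) (filter-filter P? Q? xs)
...   | false = filter-filter P? Q? xs

sum-map-upTo : (f : ℕ → ℕ) (n : ℕ) → sum (map f (upTo n)) ≡ ∑< n f
sum-map-upTo f n = trans (cong sum (map-applyUpTo id f n)) (sum-applyUpTo f n)
  where
  sum-applyUpTo : (g : ℕ → ℕ) (n : ℕ) → sum (applyUpTo g n) ≡ ∑< n g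
  sum-applyUpTo g zero    = refl
  sum-applyUpTo g (suc n) = cong (g 0 +_) (sum-applyUpTo (g ∘ suc) n)

sum-map-concatMap : {A B : Set} (w : B → ℕ) (F : A → List B) (xs : List A) →
  sum (map w (concatMap F xs)) ≡ sum (map (λ x → sum (map w (F x))) xs)
sum-map-concatMap w F []       = refl
sum-map-concatMap w F (x ∷ xs) = begin
  sum (map w (F x ++ concatMap F xs))                ≡⟨ cong sum (map-++ w (F x) _) ⟩
  sum (map w (F x) ++ map w (concatMap F xs))        ≡⟨ sum-++ (map w (F x)) _ ⟩
  sum (map w (F x)) + sum (map w (concatMap F xs))   ≡⟨ cong (sum (map w (F x)) +_) (sum-map-concatMap w F xs) ⟩
  sum (map w (F x)) + sum (map (λ x → sum (map w (F x))) xs) ∎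
  where open ≡-Reasoning

sum-pairsUpTo : (w : ℕ × ℕ → ℕ) (n : ℕ) → sum (map w (pairsUpTo n)) ≡ ∑[ k < n ] ∑[ h < 2 + k ] w (h , suc k)
sum-pairsUpTo w n = begin
  sum (map w (concatMap column (map suc (upTo n))))
    ≡⟨ sum-map-concatMap w column (map suc (upTo n)) ⟩
  sum (map (λ k → sum (map w (column k))) (map suc (upTo n)))
    ≡⟨ cong sum (map-∘ {g = λ k → sum (map w (column k))} {f = suc} (upTo n)) ⟨
  sum (map (λ k → sum (map w (column (suc k)))) (upTo n))
    ≡⟨ sum-map-upTo (λ k → sum (map w (column (suc k)))) n ⟩
  ∑[ k < n ] sum (map w (column (suc k)))
    ≡⟨ ∑-cong n (λ k _ → sum-column (suc k)) ⟩
  ∑[ k < n ] ∑[ h < 2 + k ] w (h , suc k) ∎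
  where
  open ≡-Reasoning
  column : ℕ → List (ℕ × ℕ)
  column k = map (λ h → (h , k)) (upTo (suc k))
  sum-column : ∀ k → sum (map w (column k)) ≡ ∑[ h < suc k ] w (h , k)
  sum-column k = trans (cong sum (sym (map-∘ {g = w} {f = λ h → (h , k)} (upTo (suc k))))) (sum-map-upTo (λ h → w (h , k)) (suc k))

length-filter-pairsUpTo : ∀ m {R : ℕ × ℕ → Set} (R? : U.Decidable R) → ¬ R (0 , 0) →
  (∀ h k → R (h , k) → h ≤ m × k ∸ h ≤ m) →
  length (filter R? (pairsUpTo (2 * m))) ≡ count (suc m) (λ h j → R? (h , h + j))
length-filter-pairsUpTo m R? ¬R₀₀ R⇒bounded = begin
  length (filter R? (pairsUpTo (2 * m)))
    ≡⟨ length-filter R? (pairsUpTo (2 * m)) ⟩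
  sum (map (𝟙 ∘ R?) (pairsUpTo (2 * m)))
    ≡⟨ sum-pairsUpTo (𝟙 ∘ R?) (2 * m) ⟩
  ∑[ k < 2 * m ] ∑[ h < 2 + k ] 𝟙 (R? (h , suc k))
    ≡⟨ cong (λ r → r + 0 + ∑[ k < 2 * m ] ∑[ h < 2 + k ] 𝟙 (R? (h , suc k))) (𝟙-no (R? (0 , 0)) ¬R₀₀) ⟨
  ∑[ k < suc (2 * m) ] ∑[ h < suc k ] 𝟙 (R? (h , k))
    ≡⟨ ∑-triangle (suc (2 * m)) (λ h k → 𝟙 (R? (h , k))) ⟩
  ∑[ h < suc (2 * m) ] ∑[ j < suc (2 * m) ∸ h ] 𝟙 (R? (h , h + j))
    ≡⟨ ∑-truncate (suc m) (suc (2 * m)) _ (s≤s (m≤m+n m _)) (λ h m<h → ∑-zero (suc (2 * m) ∸ h) (λ j _ → h>m⇒0 h j m<h)) ⟩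
  ∑[ h < suc m ] ∑[ j < suc (2 * m) ∸ h ] 𝟙 (R? (h , h + j))
    ≡⟨ ∑-cong (suc m) (λ h h<1+m → ∑-truncate (suc m) (suc (2 * m) ∸ h) _ (room (≤-pred h<1+m)) (j>m⇒0 h)) ⟩
  count (suc m) (λ h j → R? (h , h + j)) ∎
  where
  open ≡-Reasoning
  h>m⇒0 : ∀ h j → m < h → 𝟙 (R? (h , h + j)) ≡ 0
  h>m⇒0 h j m<h = 𝟙-no (R? (h , h + j)) (<⇒≱ m<h ∘ proj₁ ∘ R⇒bounded h (h + j))
  j>m⇒0 : ∀ h j → m < j → 𝟙 (R? (h , h + j)) ≡ 0
  j>m⇒0 h j m<j = 𝟙-no (R? (h , h + j)) (<⇒≱ m<j ∘ subst (_≤ m) (m+n∸m≡n h j) ∘ proj₂ ∘ R⇒bounded h (h + j))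
  room : ∀ {h} → h ≤ m → suc m ≤ suc (2 * m) ∸ h
  room {h} h≤m = m+n≤o⇒m≤o∸n (suc m) (s≤s (subst (m + h ≤_) (cong (m +_) (sym (+-identityʳ m))) (+-monoʳ-≤ m h≤m)))

coprime-self⇒≡1 : ∀ {n} → Coprime n n → n ≡ 1
coprime-self⇒≡1 c = c (∣-refl , ∣-refl)

coprime-double⇒≡1 : ∀ {n} → Coprime (n + n) n → n ≡ 1
coprime-double⇒≡1 c = c (∣m∣n⇒∣m+n ∣-refl ∣-refl , ∣-refl)

coprime-+ʳ : ∀ {h j} → Coprime h (h + j) ⇔ Coprime h j
coprime-+ʳ = mk⇔ (λ c {_} (d∣h , d∣j) → c (d∣h , ∣m∣n⇒∣m+n d∣h d∣j))
                 (λ c {_} (d∣h , d∣h+j) → c (d∣h , ∣m+n∣m⇒∣n d∣h+j d∣h))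

coprime-+-swap : ∀ {h e} → Coprime e (h + e) ⇔ Coprime h (h + e)
coprime-+-swap {h} {e} = mk⇔ (λ c {d} (d∣h , d∣h+e) → c (∣m+n∣m⇒∣n d∣h+e d∣h , d∣h+e))
                             (λ c {d} (d∣e , d∣h+e) → c (∣m+n∣m⇒∣n (subst (d ∣_) (+-comm h e) d∣h+e) d∣e , d∣h+e))

coprime-transpose : ∀ {R : ℕ → ℕ → Set} h j → (Coprime h j × R h j) ⇔ (Coprime j h × R h j)
coprime-transpose h j = mk⇔ (map₁ Coprime.sym) (map₁ Coprime.sym)

#coprime : ℕ → {R : ℕ → ℕ → Set} → Decidable R → ℕ
#coprime M R? = count M (λ h j → coprime? h j ×-dec R? h j)

total≡below-1+1 : ∀ {M} → 1 < M → count M coprime? ≡ #coprime M (λ _ j → 0 <? j) + 1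
total≡below-1+1 {M} 1<M = begin
  count M coprime?                                                   ≡⟨ count-trichotomy M coprime? (λ _ _ → 0) (λ _ j → j) ⟩
  #coprime M (λ _ j → 0 <? j) + #coprime M (λ _ j → j <? 0) + _     ≡⟨ cong₂ (λ b c → #coprime M (λ _ j → 0 <? j) + b + c) j<0 j≡0 ⟩
  #coprime M (λ _ j → 0 <? j) + 0 + 1                                ≡⟨ cong (_+ 1) (+-identityʳ _) ⟩
  #coprime M (λ _ j → 0 <? j) + 1                                    ∎
  where
  open ≡-Reasoning
  j<0 : #coprime M (λ _ j → j <? 0) ≡ 0
  j<0 = count-∅ M (λ h j → coprime? h j ×-dec j <? 0) (λ { _ _ (_ , ()) })
  j≡0 : #coprime M (λ _ j → 0 ≟ j) ≡ 1
  j≡0 = count-point M (λ h j → coprime? h j ×-dec 0 ≟ j) 1<M (<-trans z<s 1<M)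
    (λ h j → mk⇔ (λ { (c , refl) → 0-coprimeTo-m⇒m≡1 (Coprime.sym c) , refl })
                 (λ { (refl , refl) → 1-coprimeTo 0 , refl }))

total≡2*below-½+1 : ∀ {M} → 1 < M →
  count M coprime? ≡ #coprime M (λ h j → h <? j) + #coprime M (λ h j → h <? j) + 1
total≡2*below-½+1 {M} 1<M =
  trans (count-trichotomy M coprime? (λ h _ → h) (λ _ j → j)) (cong₂ (λ b c → #coprime M (λ h j → h <? j) + b + c) j<h h≡j)
  where
  j<h : #coprime M (λ h j → j <? h) ≡ #coprime M (λ h j → h <? j)
  j<h = count-transpose M (λ h j → coprime? h j ×-dec j <? h) (λ h j → coprime? h j ×-dec h <? j) coprime-transpose
  h≡j : #coprime M (λ h j → h ≟ j) ≡ 1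
  h≡j = count-point M (λ h j → coprime? h j ×-dec h ≟ j) 1<M 1<M
    (λ h j → mk⇔ (λ { (c , refl) → coprime-self⇒≡1 c , coprime-self⇒≡1 c })
                 (λ { (refl , refl) → 1-coprimeTo 1 , refl }))

total≡below-⅔+below-⅓+1 : ∀ {M} → 2 < M →
  count M coprime? ≡ #coprime M (λ h j → h <? j + j) + #coprime M (λ h j → h + h <? j) + 1
total≡below-⅔+below-⅓+1 {M} 2<M =
  trans (count-trichotomy M coprime? (λ h _ → h) (λ _ j → j + j)) (cong₂ (λ b c → #coprime M (λ h j → h <? j + j) + b + c) 2j<h h≡2j)
  where
  2j<h : #coprime M (λ h j → j + j <? h) ≡ #coprime M (λ h j → h + h <? j)
  2j<h = count-transpose M (λ h j → coprime? h j ×-dec j + j <? h) (λ h j → coprime? h j ×-dec h + h <? j) coprime-transpose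
  h≡2j : #coprime M (λ h j → h ≟ j + j) ≡ 1
  h≡2j = count-point M (λ h j → coprime? h j ×-dec h ≟ j + j) 2<M (<-trans (s<s z<s) 2<M)
    (λ h j → mk⇔ (λ { (c , refl) → let j≡1 = coprime-double⇒≡1 c in cong (λ n → n + n) j≡1 , j≡1 })
                 (λ { (refl , refl) → Coprime.sym (1-coprimeTo 2) , refl }))

positive-below-⅓? : Decidable (λ h j → (Coprime h j × h + h < j) × 0 < h)
positive-below-⅓? h j = (coprime? h j ×-dec h + h <? j) ×-dec 0 <? h

below-⅓≡positive-below-⅓+1 : ∀ {M} → 1 < M → #coprime M (λ h j → h + h <? j) ≡ count M positive-below-⅓? + 1
below-⅓≡positive-below-⅓+1 {M} 1<M = begin
  #coprime M (λ h j → h + h <? j)                           ≡⟨ count-trichotomy M ⅓? (λ _ _ → 0) (λ h _ → h) ⟩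
  count M positive-below-⅓? + count M (λ h j → ⅓? h j ×-dec h <? 0) + _
    ≡⟨ cong₂ (λ b c → count M positive-below-⅓? + b + c) h<0 h≡0 ⟩
  count M positive-below-⅓? + 0 + 1                         ≡⟨ cong (_+ 1) (+-identityʳ _) ⟩
  count M positive-below-⅓? + 1                             ∎
  where
  open ≡-Reasoning
  ⅓? : Decidable (λ h j → Coprime h j × h + h < j)
  ⅓? h j = coprime? h j ×-dec h + h <? j
  h<0 : count M (λ h j → ⅓? h j ×-dec h <? 0) ≡ 0
  h<0 = count-∅ M (λ h j → ⅓? h j ×-dec h <? 0) (λ { _ _ (_ , ()) })
  h≡0 : count M (λ h j → ⅓? h j ×-dec 0 ≟ h) ≡ 1
  h≡0 = count-point M (λ h j → ⅓? h j ×-dec 0 ≟ h) (<-trans z<s 1<M) 1<M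
    (λ h j → mk⇔ (λ { ((c , _) , refl) → refl , 0-coprimeTo-m⇒m≡1 c })
                 (λ { (refl , refl) → (Coprime.sym (1-coprimeTo 0) , z<s) , refl }))

below-½≡2*below-⅓ : ∀ {M} → 2 < M →
  #coprime M (λ h j → h <? j) ≡ #coprime M (λ h j → h + h <? j) + #coprime M (λ h j → h + h <? j)
below-½≡2*below-⅓ {M} 2<M = begin
  count M ½?
    ≡⟨ count-trichotomy M ½? (λ h _ → h + h) (λ _ j → j) ⟩
  count M (λ h j → ½? h j ×-dec h + h <? j) + count M (λ h j → ½? h j ×-dec j <? h + h) + _
    ≡⟨ cong₂ _+_ (cong₂ _+_ 2h<j j<2h) 2h≡j ⟩
  #⅓ + count M positive-below-⅓? + 1
    ≡⟨ +-assoc #⅓ _ 1 ⟩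
  #⅓ + (count M positive-below-⅓? + 1)
    ≡⟨ cong (#⅓ +_) (below-⅓≡positive-below-⅓+1 (<-trans (s<s z<s) 2<M)) ⟨
  #⅓ + #⅓ ∎
  where
  open ≡-Reasoning
  ½? : Decidable (λ h j → Coprime h j × h < j)
  ½? h j = coprime? h j ×-dec h <? j
  #⅓ : ℕ
  #⅓ = #coprime M (λ h j → h + h <? j)
  2h<j : count M (λ h j → ½? h j ×-dec h + h <? j) ≡ #⅓
  2h<j = count-cong M (λ h j → ½? h j ×-dec h + h <? j) (λ h j → coprime? h j ×-dec h + h <? j)
    (λ h j _ _ → mk⇔ (λ ((c , _) , 2h<j) → c , 2h<j) (λ (c , 2h<j) → (c , ≤-<-trans (m≤m+n h h) 2h<j) , 2h<j))
  j<2h : count M (λ h j → ½? h j ×-dec j <? h + h) ≡ count M positive-below-⅓?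
  j<2h = count-reflect M (λ h j → ½? h j ×-dec j <? h + h) positive-below-⅓?
    (λ { h j ((_ , h<j) , _) → <⇒≤ h<j })
    (λ { h j ((_ , 2h<j) , _) → ≤-trans (m≤m+n h h) (<⇒≤ 2h<j) })
    (λ h e → mk⇔
      (λ ((c , e<h+e) , h+e<2e) → (Equivalence.to coprime-+-swap c , +-monoʳ-< h (+-cancelʳ-< e h e h+e<2e)) , +-cancelʳ-< e 0 h e<h+e)
      (λ ((c , 2h<h+e) , 0<h) → (Equivalence.from coprime-+-swap c , +-monoˡ-< e 0<h) , +-monoˡ-< e (+-cancelˡ-< h h e 2h<h+e)))
  2h≡j : count M (λ h j → ½? h j ×-dec h + h ≟ j) ≡ 1
  2h≡j = count-point M (λ h j → ½? h j ×-dec h + h ≟ j) (<-trans (s<s z<s) 2<M) 2<M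
    (λ h j → mk⇔ (λ { ((c , _) , refl) → let h≡1 = coprime-double⇒≡1 (Coprime.sym c) in h≡1 , cong (λ n → n + n) h≡1 })
                 (λ { (refl , refl) → (1-coprimeTo 2 , ≤-refl) , refl }))

coprime-counts-in-ratio : ∀ {M} → 2 < M →
  let t = #coprime M (λ h j → h + h <? j) in
  (#coprime M (λ h j → h <? j) ≡ 2 * t) × (#coprime M (λ h j → h <? j + j) ≡ 3 * t) × (#coprime M (λ _ j → 0 <? j) ≡ 4 * t)
coprime-counts-in-ratio {M} 2<M = ½≡2t , ⅔≡3t , 1≡4t
  where
  1<M : 1 < M
  1<M = <-trans (s<s z<s) 2<M
  t x½ x⅔ x1 N : ℕ
  t  = #coprime M (λ h j → h + h <? j)
  x½ = #coprime M (λ h j → h <? j)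
  x⅔ = #coprime M (λ h j → h <? j + j)
  x1 = #coprime M (λ _ j → 0 <? j)
  N  = count M coprime?
  ½≡2t : x½ ≡ 2 * t
  ½≡2t = trans (below-½≡2*below-⅓ 2<M) (double t)
    where double : ∀ t → t + t ≡ 2 * t
          double = solve-∀
  N≡4t+1 : N ≡ 4 * t + 1
  N≡4t+1 = trans (total≡2*below-½+1 1<M) (cong (_+ 1) (trans (cong₂ _+_ ½≡2t ½≡2t) (quadruple t)))
    where quadruple : ∀ t → 2 * t + 2 * t ≡ 4 * t
          quadruple = solve-∀
  ⅔≡3t : x⅔ ≡ 3 * t
  ⅔≡3t = +-cancelʳ-≡ t x⅔ (3 * t) (+-cancelʳ-≡ 1 (x⅔ + t) (3 * t + t)
    (trans (sym (total≡below-⅔+below-⅓+1 2<M)) (trans N≡4t+1 (cong (_+ 1) (split t)))))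
    where split : ∀ t → 4 * t ≡ 3 * t + t
          split = solve-∀
  1≡4t : x1 ≡ 4 * t
  1≡4t = +-cancelʳ-≡ 1 x1 (4 * t) (trans (sym (total≡below-1+1 1<M)) N≡4t+1)

¬inFB-0/0 : ∀ {m} → ¬ inFB m (0 , 0)
¬inFB-0/0 (() , _)

inFB⇔coprime : ∀ {m h j} → h ≤ m → j ≤ m → inFB m (h , h + j) ⇔ Coprime h j
inFB⇔coprime {m} {h} {j} h≤m j≤m = mk⇔
  (λ (gcd≡1 , _) → Equivalence.to coprime-+ʳ (gcd≡1⇒coprime gcd≡1))
  (λ (c : Coprime h j) → coprime⇒gcd≡1 (Equivalence.from coprime-+ʳ c) , h≤m , subst (_≤ m) (sym (m+n∸m≡n h j)) j≤m)

length-FB : ∀ m → length (FB m) ≡ count (suc m) coprime?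
length-FB m = trans (length-filter-pairsUpTo m (inFB? m) ¬inFB-0/0 (λ _ _ → proj₂))
  (count-cong (suc m) (λ h j → inFB? m (h , h + j)) coprime? (λ h j h<1+m j<1+m → inFB⇔coprime (≤-pred h<1+m) (≤-pred j<1+m)))

index≡#coprime : ∀ m a b {R : ℕ → ℕ → Set} (R? : Decidable R) →
  (∀ h j → h * b < a * (h + j) ⇔ R h j) → index m a b ≡ #coprime (suc m) R?
index≡#coprime m a b R? below⇔R = begin
  length (filter below? (filter (inFB? m) (pairsUpTo (2 * m))))
    ≡⟨ cong length (filter-filter (inFB? m) below? (pairsUpTo (2 * m))) ⟩
  length (filter (λ p → inFB? m p ×-dec below? p) (pairsUpTo (2 * m)))
    ≡⟨ length-filter-pairsUpTo m (λ p → inFB? m p ×-dec below? p) (¬inFB-0/0 ∘ proj₁) (λ _ _ → proj₂ ∘ proj₁) ⟩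
  count (suc m) (λ h j → inFB? m (h , h + j) ×-dec below? (h , h + j))
    ≡⟨ count-cong (suc m) (λ h j → inFB? m (h , h + j) ×-dec below? (h , h + j)) (λ h j → coprime? h j ×-dec R? h j)
         (λ h j h<1+m j<1+m → inFB⇔coprime (≤-pred h<1+m) (≤-pred j<1+m) ×-⇔ below⇔R h j) ⟩
  #coprime (suc m) R? ∎
  where
  open ≡-Reasoning
  below? : U.Decidable (λ (p : ℕ × ℕ) → proj₁ p * b < a * proj₂ p)
  below? (h , k) = h * b <? a * k

+-cancelˡ-<-⇔ : ∀ k {x y X Y} → X ≡ k + x → Y ≡ k + y → X < Y ⇔ x < y
+-cancelˡ-<-⇔ k refl refl = mk⇔ (+-cancelˡ-< k _ _) (+-monoʳ-< k)

h/h+j<1/3⇔ : ∀ h j → h * 3 < 1 * (h + j) ⇔ h + h < j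
h/h+j<1/3⇔ h j = +-cancelˡ-<-⇔ h (triple h) (+-identityʳ (h + j))
  where triple : ∀ h → h * 3 ≡ h + (h + h)
        triple = solve-∀

h/h+j<1/2⇔ : ∀ h j → h * 2 < 1 * (h + j) ⇔ h < j
h/h+j<1/2⇔ h j = +-cancelˡ-<-⇔ h (double h) (+-identityʳ (h + j))
  where double : ∀ h → h * 2 ≡ h + h
        double = solve-∀

h/h+j<2/3⇔ : ∀ h j → h * 3 < 2 * (h + j) ⇔ h < j + j
h/h+j<2/3⇔ h j = +-cancelˡ-<-⇔ (h + h) (triple h) (double h j)
  where triple : ∀ h → h * 3 ≡ h + h + h
        triple = solve-∀
        double : ∀ h j → 2 * (h + j) ≡ h + h + (j + j)
        double = solve-∀

h/h+j<1⇔ : ∀ h j → h * 1 < 1 * (h + j) ⇔ 0 < j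
h/h+j<1⇔ h j = +-cancelˡ-<-⇔ h (trans (*-identityʳ h) (sym (+-identityʳ h))) (+-identityʳ (h + j))

mainTheorem2 : (m : ℕ) → 1 < m →
    (index m 1 2 ≡ 2 * index m 1 3) ×
    (index m 2 3 ≡ 3 * index m 1 3) ×
    (index m 1 1 ≡ 4 * index m 1 3) ×
    (4 ∣ (length (FB m) ∸ 1))
mainTheorem2 m 1<m with coprime-counts-in-ratio (s<s 1<m)
... | ½≡2t , ⅔≡3t , 1≡4t =
  in-thirds 2 below-½ ½≡2t , in-thirds 3 below-⅔ ⅔≡3t , in-thirds 4 below-1 1≡4t ,
  subst (4 ∣_) (sym (in-thirds 4 length-1 1≡4t)) (m∣m*n (index m 1 3))
  where
  below-⅓ : index m 1 3 ≡ #coprime (suc m) (λ h j → h + h <? j)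
  below-⅓ = index≡#coprime m 1 3 (λ h j → h + h <? j) h/h+j<1/3⇔
  below-½ : index m 1 2 ≡ #coprime (suc m) (λ h j → h <? j)
  below-½ = index≡#coprime m 1 2 (λ h j → h <? j) h/h+j<1/2⇔
  below-⅔ : index m 2 3 ≡ #coprime (suc m) (λ h j → h <? j + j)
  below-⅔ = index≡#coprime m 2 3 (λ h j → h <? j + j) h/h+j<2/3⇔
  below-1 : index m 1 1 ≡ #coprime (suc m) (λ _ j → 0 <? j)
  below-1 = index≡#coprime m 1 1 (λ _ j → 0 <? j) h/h+j<1⇔
  length-1 : length (FB m) ∸ 1 ≡ #coprime (suc m) (λ _ j → 0 <? j)
  length-1 = trans (cong (_∸ 1) (trans (length-FB m) (total≡below-1+1 (s<s (<-trans z<s 1<m))))) (m+n∸n≡m _ 1)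
  in-thirds : ∀ {x y} k → x ≡ y → y ≡ k * #coprime (suc m) (λ h j → h + h <? j) → x ≡ k * index m 1 3
  in-thirds k x≡y y≡kt = trans x≡y (trans y≡kt (cong (k *_) (sym below-⅓)))
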